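{- Let $p$ be an ideal prime for a strong divisibility sequence $C$, with associated integer $s(p)\ge1$. For any integer $n\ge0$, write $n=\alpha(p)n'+r$ with $0\le r<\alpha(p)$ and $n'\in\mathbb N$. Then \[ \sum_{m=0}^{n}x^{\nu_p\left(\binom{n}{m}_C\right)}=(r+1)\sum_{m'=0}^{n'}x^{\nu_p\left(\binom{n'}{m'}\right)}+(\alpha(p)-r-1)x^{s(p)-1}\sum_{m'=0}^{n'-1}x^{1+\nu_p\left(n'\binom{n'-1}{m'}\right)}, \] where the last sum is empty (equal to $0$) when $n'=0$.
   Context: A strong divisibility sequence is a sequence $C=C_1,C_2,\dots$ of nonzero integers with $\gcd(C_n,C_m)=C_{\gcd(n,m)}$ for all positive $n,m$. The $C$-orial is $0!_C=1$, $n!_C=C_nC_{n-1}\cdots C_1$ for $n\ge1$, and $\binom{n}{m}_C=\frac{n!_C}{m!_C(n-m)!_C}$ for $0\le m\le n$. $\nu_p$ is the $p$-adic valuation. The rank of apparition $\alpha(m)$ is the least index $j\ge1$ with $m\mid C_j$ (if it exists). When $\alpha(p^k)$ exists for all $k\ge1$, set $a_k(p)=\alpha(p^k)/\alpha(p^{k-1})$ for $k\ge2$. The prime $p$ is ideal for $C$ if $\alpha(p^k)$ exists for all $k\ge1$ and there is an integer $s(p)\ge1$ with $a_k(p)=1$ for $2\le k\le s(p)$ and $a_k(p)=p$ for $k>s(p)$. -}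

module Defs where

open import Data.Nat as ℕ using (ℕ; zero; suc; _+_; _*_; _∸_; _^_; _≤_; _<_)
open import Data.Nat.Divisibility using (_∣?_; divides)
open import Data.Nat.GCD using (gcd)
open import Data.Nat.Combinatorics using (_C_)
open import Data.Integer as ℤ using (ℤ; ∣_∣)
open import Data.Integer.Divisibility as ℤD using ()
open import Data.Integer.GCD as ℤG using ()
open import Data.List using (List; map; upTo)
open import Data.Nat.ListAction using (sum)
open import Relation.Nullary using (¬_; yes; no)
open import Relation.Binary.PropositionalEquality using (_≡_; _≢_)

-- A sequence C₁, C₂, … of integers is modelled as C : ℕ → ℤ ;
-- the value C 0 is irrelevant and never constrained.

record StrongDivSeq (c : ℕ → ℤ) : Set where
  field
    nonzero : ∀ n → 1 ≤ n → c n ≢ ℤ.0ℤ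
    gcd-eq  : ∀ n m → 1 ≤ n → 1 ≤ m → ℤG.gcd (c n) (c m) ≡ c (gcd n m)

orial : (ℕ → ℤ) → ℕ → ℤ
orial c zero    = ℤ.1ℤ
orial c (suc n) = c (suc n) ℤ.* orial c n

-- p-adic valuation of a natural number (by repeated division, with fuel).
-- For a prime p and n ≥ 1, the fuel n is sufficient, so νℕ p n is the
-- largest k with p ^ k ∣ n.
νAux : ℕ → ℕ → ℕ → ℕ
νAux zero    p n = 0
νAux (suc f) p n with p ∣? n
... | yes (divides q _) = suc (νAux f p q)
... | no _              = 0

νℕ : ℕ → ℕ → ℕ
νℕ p n = νAux n p n

-- p-adic valuation of an integer (used only for nonzero integers)
νℤ : ℕ → ℤ → ℕ
νℤ p z = νℕ p ∣ z ∣

-- ν_p of the C-binomial  n!_C / (m!_C (n-m)!_C)  (for m ≤ n), computed as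
-- ν_p(n!_C) - ν_p(m!_C) - ν_p((n-m)!_C).  This is ≥ 0 since C-binomials of a
-- strong divisibility sequence are integers, so truncated subtraction is exact.
νCbinom : (ℕ → ℤ) → ℕ → ℕ → ℕ → ℕ
νCbinom c p n m = νℤ p (orial c n) ∸ (νℤ p (orial c m) + νℤ p (orial c (n ∸ m)))

IsRank : (ℕ → ℤ) → ℕ → ℕ → Set
IsRank c d j = 1 ≤ j × ((ℤ.+ d) ℤD.∣ c j) × (∀ i → 1 ≤ i → i < j → ¬ ((ℤ.+ d) ℤD.∣ c i))
  where open import Data.Product using (_×_)

-- p is an ideal prime for C, with α k = α(p^k) for k ≥ 1 and integer s = s(p) ≥ 1:
-- a_k = α(p^k)/α(p^(k-1)) equals 1 for 2 ≤ k ≤ s and p for k > s.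
record Ideal (c : ℕ → ℤ) (p : ℕ) (α : ℕ → ℕ) (s : ℕ) : Set where
  field
    rank   : ∀ k → 1 ≤ k → IsRank c (p ^ k) (α k)
    s≥1    : 1 ≤ s
    a-one  : ∀ k → 2 ≤ k → k ≤ s → α k ≡ 1 * α (k ∸ 1)
    a-p    : ∀ k → 2 ≤ k → s < k → α k ≡ p * α (k ∸ 1)

Σ< : ℕ → (ℕ → ℕ) → ℕ
Σ< N f = sum (map f (upTo N))

{-# OPTIONS --safe #-}
module Submission where

-- Strong divisibility gives p ^ j ∣ C k iff α(p^j) ∣ k, and idealness gives
-- α(p^(s+t)) = p^t α(p).  Hence ν_p(C k) = 0 unless α(p) ∣ k, while
-- ν_p(C (α(p) k)) = s + ν_p(k), so ν_p((α(p) q + r)!_C) = s q + ν_p(q!) for r < α(p).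
-- For m = α(p) j + i the C-binomial thus has valuation ν_p(binom n' j) when i ≤ r,
-- and s + ν_p(n' binom (n'-1) j) when i > r, because then the subtraction n - m
-- borrows a block: n - m = α(p) (n' - 1 - j) + (α(p) + r - i).  Each block j ≤ n'
-- holds r + 1 values of m of the first kind, each block j < n' holds α(p) - r - 1
-- of the second.

open import Defs
open import Data.Nat using (ℕ; zero; suc; pred; _+_; _*_; _∸_; _^_; _<_; _≤_; z≤n; s≤s; z<s; _!)
open import Data.Nat.Base using (NonZero; >-nonZero; >-nonZero⁻¹; nonTrivial⇒n>1)
open import Data.Nat.Properties
open import Data.Nat.Divisibility
  using (_∣_; _∣?_; divides; _∣0; ∣1⇒≡1; ∣-trans; ∣-antisym; ∣-refl; ∣⇒≤; 1∣_; m∣m*n; *-monoˡ-∣; *-cancelˡ-∣; ∣m+n∣m⇒∣n)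
open import Data.Nat.DivMod using (m/n*n≡m)
open import Data.Nat.GCD using (gcd; gcd[m,n]∣m; gcd[m,n]∣n; gcd-greatest; gcd[m,n]≢0)
open import Data.Nat.Primality using (Prime; prime⇒nonZero; prime⇒nonTrivial; euclidsLemma)
open import Data.Nat.Combinatorics using (_C_; k![n∸k]!∣n!)
open import Data.Nat.Combinatorics.Specification using (nCk≡n!/k![n-k]!)
open import Data.Nat.ListAction using (sum)
open import Data.Nat.ListAction.Properties using (sum-++)
open import Data.Nat.Tactic.RingSolver using (solve-∀)
open import Data.Integer using (ℤ; ∣_∣)
open import Data.Integer.Properties using (∣i∣≡0⇒i≡0; abs-*)
open import Data.List using ([_]; upTo; map; _∷ʳ_)
open import Data.List.Properties using (upTo-∷ʳ; map-++)
open import Data.Product using (_×_; _,_; proj₁; proj₂; ∃-syntax)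
open import Data.Sum using (inj₂; [_,_]′)
open import Algebra.Properties.CommutativeSemigroup +-commutativeSemigroup
  using () renaming (interchange to +-interchange)
open import Algebra.Properties.CommutativeSemigroup *-commutativeSemigroup
  using () renaming (interchange to *-interchange)
open import Function using (_∘_)
open import Relation.Nullary using (¬_; yes; no; contradiction)
open import Relation.Binary.PropositionalEquality
  using (_≡_; refl; sym; trans; cong; cong₂; subst; subst₂; module ≡-Reasoning)
open ≡-Reasoning

Σ<-suc : ∀ N f → Σ< (suc N) f ≡ Σ< N f + f N
Σ<-suc N f = begin
  sum (map f (upTo (suc N)))   ≡⟨ cong (sum ∘ map f) (upTo-∷ʳ N) ⟨
  sum (map f (upTo N ∷ʳ N))    ≡⟨ cong sum (map-++ f (upTo N) [ N ]) ⟩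
  sum (map f (upTo N) ∷ʳ f N)  ≡⟨ sum-++ (map f (upTo N)) [ f N ] ⟩
  Σ< N f + (f N + 0)           ≡⟨ cong (Σ< N f +_) (+-identityʳ (f N)) ⟩
  Σ< N f + f N                 ∎

Σ<-cong : ∀ {N f g} → (∀ {i} → i < N → f i ≡ g i) → Σ< N f ≡ Σ< N g
Σ<-cong {zero}          f≗g = refl
Σ<-cong {suc N} {f} {g} f≗g = begin
  Σ< (suc N) f  ≡⟨ Σ<-suc N f ⟩
  Σ< N f + f N  ≡⟨ cong₂ _+_ (Σ<-cong (f≗g ∘ m<n⇒m<1+n)) (f≗g (n<1+n N)) ⟩
  Σ< N g + g N  ≡⟨ Σ<-suc N g ⟨
  Σ< (suc N) g  ∎

Σ<-const : ∀ N k → Σ< N (λ _ → k) ≡ N * k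
Σ<-const zero    k = refl
Σ<-const (suc N) k = begin
  Σ< (suc N) (λ _ → k)  ≡⟨ Σ<-suc N _ ⟩
  Σ< N (λ _ → k) + k    ≡⟨ cong (_+ k) (Σ<-const N k) ⟩
  N * k + k             ≡⟨ +-comm (N * k) k ⟩
  suc N * k             ∎

Σ<-+ : ∀ N f g → Σ< N (λ i → f i + g i) ≡ Σ< N f + Σ< N g
Σ<-+ zero    f g = refl
Σ<-+ (suc N) f g = begin
  Σ< (suc N) (λ i → f i + g i)           ≡⟨ Σ<-suc N _ ⟩
  Σ< N (λ i → f i + g i) + (f N + g N)   ≡⟨ cong (_+ (f N + g N)) (Σ<-+ N f g) ⟩
  (Σ< N f + Σ< N g) + (f N + g N)        ≡⟨ +-interchange (Σ< N f) (Σ< N g) (f N) (g N) ⟩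
  (Σ< N f + f N) + (Σ< N g + g N)        ≡⟨ cong₂ _+_ (Σ<-suc N f) (Σ<-suc N g) ⟨
  Σ< (suc N) f + Σ< (suc N) g            ∎

Σ<-*ˡ : ∀ N k f → Σ< N (λ i → k * f i) ≡ k * Σ< N f
Σ<-*ˡ zero    k f = sym (*-zeroʳ k)
Σ<-*ˡ (suc N) k f = begin
  Σ< (suc N) (λ i → k * f i)     ≡⟨ Σ<-suc N _ ⟩
  Σ< N (λ i → k * f i) + k * f N ≡⟨ cong (_+ k * f N) (Σ<-*ˡ N k f) ⟩
  k * Σ< N f + k * f N           ≡⟨ *-distribˡ-+ k (Σ< N f) (f N) ⟨
  k * (Σ< N f + f N)             ≡⟨ cong (k *_) (Σ<-suc N f) ⟨
  k * Σ< (suc N) f               ∎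

Σ<-split : ∀ a b f → Σ< (a + b) f ≡ Σ< a f + Σ< b (λ i → f (a + i))
Σ<-split a zero    f = trans (cong (λ t → Σ< t f) (+-identityʳ a)) (sym (+-identityʳ (Σ< a f)))
Σ<-split a (suc b) f = begin
  Σ< (a + suc b) f                                   ≡⟨ cong (λ t → Σ< t f) (+-suc a b) ⟩
  Σ< (suc (a + b)) f                                 ≡⟨ Σ<-suc (a + b) f ⟩
  Σ< (a + b) f + f (a + b)                           ≡⟨ cong (_+ f (a + b)) (Σ<-split a b f) ⟩
  (Σ< a f + Σ< b (λ i → f (a + i))) + f (a + b)      ≡⟨ +-assoc (Σ< a f) _ _ ⟩
  Σ< a f + (Σ< b (λ i → f (a + i)) + f (a + b))      ≡⟨ cong (Σ< a f +_) (Σ<-suc b _) ⟨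
  Σ< a f + Σ< (suc b) (λ i → f (a + i))              ∎

Σ<-blocks : ∀ A q f → Σ< (A * q) f ≡ Σ< q (λ j → Σ< A (λ i → f (A * j + i)))
Σ<-blocks A zero    f = cong (λ t → Σ< t f) (*-zeroʳ A)
Σ<-blocks A (suc q) f = begin
  Σ< (A * suc q) f                                        ≡⟨ cong (λ t → Σ< t f) (trans (*-suc A q) (+-comm A (A * q))) ⟩
  Σ< (A * q + A) f                                        ≡⟨ Σ<-split (A * q) A f ⟩
  Σ< (A * q) f + Σ< A (λ i → f (A * q + i))               ≡⟨ cong (_+ Σ< A (λ i → f (A * q + i))) (Σ<-blocks A q f) ⟩
  Σ< q (λ j → Σ< A (λ i → f (A * j + i))) + Σ< A (λ i → f (A * q + i)) ≡⟨ Σ<-suc q _ ⟨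
  Σ< (suc q) (λ j → Σ< A (λ i → f (A * j + i)))           ∎

Σ<-periodic : ∀ A n' r {f u v : ℕ → ℕ} → r < A
  → (∀ {j i} → j ≤ n' → i ≤ r → f (A * j + i) ≡ u j)
  → (∀ {j i} → j < n' → r < i → i < A → f (A * j + i) ≡ v j)
  → Σ< (suc (A * n' + r)) f ≡ (r + 1) * Σ< (suc n') u + (A ∸ r ∸ 1) * Σ< n' v
Σ<-periodic A n' r {f} {u} {v} r<A f≡u f≡v = begin
  Σ< (suc (A * n' + r)) f                                 ≡⟨ cong (λ t → Σ< t f) (+-suc (A * n') r) ⟨
  Σ< (A * n' + suc r) f                                   ≡⟨ Σ<-split (A * n') (suc r) f ⟩
  Σ< (A * n') f + Σ< (suc r) (row n')                     ≡⟨ cong₂ _+_ (Σ<-blocks A n' f) (head ≤-refl) ⟩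
  Σ< n' (λ j → Σ< A (row j)) + suc r * u n'               ≡⟨ cong (_+ suc r * u n') (Σ<-cong block) ⟩
  Σ< n' (λ j → suc r * u j + k * v j) + suc r * u n'      ≡⟨ cong (_+ suc r * u n') (Σ<-+ n' _ _) ⟩
  (Σ< n' (λ j → suc r * u j) + Σ< n' (λ j → k * v j)) + suc r * u n'
    ≡⟨ cong (λ t → t + suc r * u n') (cong₂ _+_ (Σ<-*ˡ n' (suc r) u) (Σ<-*ˡ n' k v)) ⟩
  (suc r * Σ< n' u + k * Σ< n' v) + suc r * u n'          ≡⟨ regroup r (Σ< n' u) (u n') (k * Σ< n' v) ⟩
  (r + 1) * (Σ< n' u + u n') + k * Σ< n' v                ≡⟨ cong (λ t → (r + 1) * t + k * Σ< n' v) (Σ<-suc n' u) ⟨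
  (r + 1) * Σ< (suc n') u + k * Σ< n' v                   ∎
  where
  k : ℕ
  k = A ∸ r ∸ 1
  row : ℕ → ℕ → ℕ
  row j i = f (A * j + i)
  A≡1+r+k : A ≡ suc r + k
  A≡1+r+k = sym (trans (cong (suc r +_) (trans (∸-+-assoc A r 1) (cong (A ∸_) (+-comm r 1)))) (m+[n∸m]≡n r<A))
  head : ∀ {j} → j ≤ n' → Σ< (suc r) (row j) ≡ suc r * u j
  head j≤n' = trans (Σ<-cong (f≡u j≤n' ∘ ≤-pred)) (Σ<-const (suc r) _)
  tail : ∀ {j} → j < n' → Σ< k (λ i → row j (suc r + i)) ≡ k * v j
  tail j<n' = trans (Σ<-cong λ i<k → f≡v j<n' (s≤s (m≤m+n r _)) (subst (_ <_) (sym A≡1+r+k) (+-monoʳ-< (suc r) i<k)))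
                    (Σ<-const k _)
  block : ∀ {j} → j < n' → Σ< A (row j) ≡ suc r * u j + k * v j
  block {j} j<n' = begin
    Σ< A (row j)                                        ≡⟨ cong (λ t → Σ< t (row j)) A≡1+r+k ⟩
    Σ< (suc r + k) (row j)                              ≡⟨ Σ<-split (suc r) k (row j) ⟩
    Σ< (suc r) (row j) + Σ< k (λ i → row j (suc r + i)) ≡⟨ cong₂ _+_ (head (<⇒≤ j<n')) (tail j<n') ⟩
    suc r * u j + k * v j                               ∎
  regroup : ∀ r a b c → ((1 + r) * a + c) + (1 + r) * b ≡ (r + 1) * (a + b) + c
  regroup = solve-∀

m∤m*q+r : ∀ {m} q {r} → 0 < r → r < m → ¬ m ∣ m * q + r
m∤m*q+r {m} q {r} r>0 r<m m∣m*q+r = <⇒≱ r<m (∣⇒≤ {{>-nonZero r>0}} (∣m+n∣m⇒∣n m∣m*q+r (m∣m*n q)))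

x^[s+y]≡x^[s∸1]*x^[1+y] : ∀ x {s} → 0 < s → ∀ y → x ^ (s + y) ≡ x ^ (s ∸ 1) * x ^ (1 + y)
x^[s+y]≡x^[s∸1]*x^[1+y] x {suc s} _ y = trans (cong (x ^_) (sym (+-suc s y))) (^-distribˡ-+-* x s (1 + y))

nCk*[k!*[n∸k]!]≡n! : ∀ {n k} → k ≤ n → (n C k) * (k ! * (n ∸ k) !) ≡ n !
nCk*[k!*[n∸k]!]≡n! {n} {k} k≤n =
  trans (cong (_* (k ! * (n ∸ k) !)) (nCk≡n!/k![n-k]! k≤n)) (m/n*n≡m (k![n∸k]!∣n! k≤n))
  where
  instance
    k!*[n∸k]!≢0 : NonZero (k ! * (n ∸ k) !)
    k!*[n∸k]!≢0 = k !* (n ∸ k) !≢0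

nCk>0 : ∀ {n k} → k ≤ n → 0 < n C k
nCk>0 {n} {k} k≤n = >-nonZero⁻¹ (n C k) {{m*n≢0⇒m≢0 (n C k) {{n!≢0}}}}
  where
  n!≢0 : NonZero ((n C k) * (k ! * (n ∸ k) !))
  n!≢0 = subst NonZero (sym (nCk*[k!*[n∸k]!]≡n! k≤n)) (n !≢0)

module Valuation (p : ℕ) (p-prime : Prime p) where

  instance
    p≢0 : NonZero p
    p≢0 = prime⇒nonZero p-prime

  1<p : 1 < p
  1<p = nonTrivial⇒n>1 p {{prime⇒nonTrivial p-prime}}

  p∤1 : ¬ p ∣ 1
  p∤1 p∣1 = <-irrefl (sym (∣1⇒≡1 p∣1)) 1<p

  private
    p*x*q≡x*q*p : ∀ p x q → p * x * q ≡ x * q * p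
    p*x*q≡x*q*p = solve-∀

    quotient-bounds : ∀ {q N} → N ≡ q * p → 0 < N → 0 < q × q < N
    quotient-bounds {suc q} refl _ = z<s , m<m*n (suc q) p 1<p

    p^v*q>0 : ∀ v {q} → ¬ p ∣ q → 0 < p ^ v * q
    p^v*q>0 v {zero}  p∤0 = contradiction (p ∣0) p∤0
    p^v*q>0 v {suc q} _   = *-mono-≤ (m^n>0 p v) z<s

  -- Each division by p shrinks N, so fuel f ≥ N never runs out.
  νAux-factor : ∀ f {N} → 0 < N → N ≤ f → ∃[ q ] N ≡ p ^ νAux f p N * q × ¬ p ∣ q
  νAux-factor zero    N>0 N≤0 = contradiction (<-≤-trans N>0 N≤0) n≮0
  νAux-factor (suc f) {N} N>0 N≤1+f with p ∣? N
  ... | no p∤N = N , sym (*-identityˡ N) , p∤N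
  ... | yes (divides q N≡q*p) =
    let q>0 , q<N = quotient-bounds N≡q*p N>0
        q₀ , q≡p^v*q₀ , p∤q₀ = νAux-factor f q>0 (≤-pred (≤-trans q<N N≤1+f))
    in q₀ , trans N≡q*p (trans (cong (_* p) q≡p^v*q₀) (sym (p*x*q≡x*q*p p _ q₀))) , p∤q₀

  νAux-p^v*q : ∀ f v {q} → ¬ p ∣ q → p ^ v * q ≤ f → νAux f p (p ^ v * q) ≡ v
  νAux-p^v*q zero    v p∤q N≤0 = contradiction (<-≤-trans (p^v*q>0 v p∤q) N≤0) n≮0
  νAux-p^v*q (suc f) v {q} p∤q N≤1+f with p ∣? p ^ v * q
  νAux-p^v*q (suc f) zero    p∤q _ | yes p∣q = contradiction (subst (p ∣_) (+-identityʳ _) p∣q) p∤q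
  νAux-p^v*q (suc f) (suc v) {q} p∤q N≤1+f | yes (divides q' N≡q'*p) =
    cong suc (trans (cong (νAux f p) q'≡p^v*q) (νAux-p^v*q f v p∤q p^v*q≤f))
    where
    q'≡p^v*q : q' ≡ p ^ v * q
    q'≡p^v*q = *-cancelʳ-≡ q' (p ^ v * q) p (trans (sym N≡q'*p) (p*x*q≡x*q*p p (p ^ v) q))
    p^v*q≤f : p ^ v * q ≤ f
    p^v*q≤f = subst (_≤ f) q'≡p^v*q
      (≤-pred (≤-trans (proj₂ (quotient-bounds N≡q'*p (p^v*q>0 (suc v) p∤q))) N≤1+f))
  νAux-p^v*q (suc f) zero    p∤q _ | no _ = refl
  νAux-p^v*q (suc f) (suc v) {q} p∤q _ | no p∤N = contradiction (divides (p ^ v * q) (p*x*q≡x*q*p p (p ^ v) q)) p∤N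

  ν-factor : ∀ {N} → 0 < N → ∃[ q ] N ≡ p ^ νℕ p N * q × ¬ p ∣ q
  ν-factor {N} N>0 = νAux-factor N N>0 ≤-refl

  ν[p^v*q]≡v : ∀ v {q} → ¬ p ∣ q → νℕ p (p ^ v * q) ≡ v
  ν[p^v*q]≡v v p∤q = νAux-p^v*q _ v p∤q ≤-refl

  ν[1]≡0 : νℕ p 1 ≡ 0
  ν[1]≡0 = ν[p^v*q]≡v 0 p∤1

  ν[m*n]≡ν[m]+ν[n] : ∀ {m n} → 0 < m → 0 < n → νℕ p (m * n) ≡ νℕ p m + νℕ p n
  ν[m*n]≡ν[m]+ν[n] {m} {n} m>0 n>0 with ν-factor m>0 | ν-factor n>0
  ... | a , m≡p^u*a , p∤a | b , n≡p^v*b , p∤b =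
    trans (cong (νℕ p) m*n≡p^[u+v]*[a*b]) (ν[p^v*q]≡v _ ([ p∤a , p∤b ]′ ∘ euclidsLemma a b p-prime))
    where
    u v : ℕ
    u = νℕ p m
    v = νℕ p n
    m*n≡p^[u+v]*[a*b] : m * n ≡ p ^ (u + v) * (a * b)
    m*n≡p^[u+v]*[a*b] = begin
      m * n                      ≡⟨ cong₂ _*_ m≡p^u*a n≡p^v*b ⟩
      (p ^ u * a) * (p ^ v * b)  ≡⟨ *-interchange (p ^ u) a (p ^ v) b ⟩
      (p ^ u * p ^ v) * (a * b)  ≡⟨ cong (_* (a * b)) (^-distribˡ-+-* p u v) ⟨
      p ^ (u + v) * (a * b)      ∎

  p^e∣n∧p^[1+e]∤n⇒ν≡e : ∀ e {N} → p ^ e ∣ N → ¬ p ^ suc e ∣ N → νℕ p N ≡ e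
  p^e∣n∧p^[1+e]∤n⇒ν≡e e {N} (divides d N≡d*p^e) p^[1+e]∤N =
    trans (cong (νℕ p) (trans N≡d*p^e (*-comm d (p ^ e)))) (ν[p^v*q]≡v e p∤d)
    where
    p∤d : ¬ p ∣ d
    p∤d p∣d = p^[1+e]∤N (subst (p ^ suc e ∣_) (sym N≡d*p^e) (*-monoˡ-∣ (p ^ e) p∣d))

  ν[[k+d]!]≡ν[[k+d]Ck]+ν[k!]+ν[d!] : ∀ k d →
    νℕ p ((k + d) !) ≡ νℕ p ((k + d) C k) + (νℕ p (k !) + νℕ p (d !))
  ν[[k+d]!]≡ν[[k+d]Ck]+ν[k!]+ν[d!] k d = begin
    νℕ p ((k + d) !)                                   ≡⟨ cong (νℕ p) (nCk*[k!*[n∸k]!]≡n! (m≤m+n k d)) ⟨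
    νℕ p (((k + d) C k) * (k ! * (k + d ∸ k) !))       ≡⟨ cong (λ t → νℕ p (((k + d) C k) * (k ! * t !))) (m+n∸m≡n k d) ⟩
    νℕ p (((k + d) C k) * (k ! * d !))                 ≡⟨ ν[m*n]≡ν[m]+ν[n] (nCk>0 (m≤m+n k d)) (*-mono-≤ (1≤n! k) (1≤n! d)) ⟩
    νℕ p ((k + d) C k) + νℕ p (k ! * d !)              ≡⟨ cong (νℕ p ((k + d) C k) +_) (ν[m*n]≡ν[m]+ν[n] (1≤n! k) (1≤n! d)) ⟩
    νℕ p ((k + d) C k) + (νℕ p (k !) + νℕ p (d !))     ∎

module StrongDivSeqProperties {c : ℕ → ℤ} (sds : StrongDivSeq c) where

  open StrongDivSeq sds

  ∣c∣>0 : ∀ {k} → 0 < k → 0 < ∣ c k ∣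
  ∣c∣>0 {k} k>0 = n≢0⇒n>0 (nonzero k k>0 ∘ ∣i∣≡0⇒i≡0)

  gcd[∣c∣]≡∣c[gcd]∣ : ∀ {m n} → 0 < m → 0 < n → gcd ∣ c m ∣ ∣ c n ∣ ≡ ∣ c (gcd m n) ∣
  gcd[∣c∣]≡∣c[gcd]∣ m>0 n>0 = cong ∣_∣ (gcd-eq _ _ m>0 n>0)

  m∣n⇒∣c[m]∣∣∣c[n]∣ : ∀ {m n} → 0 < m → 0 < n → m ∣ n → ∣ c m ∣ ∣ ∣ c n ∣
  m∣n⇒∣c[m]∣∣∣c[n]∣ {m} {n} m>0 n>0 m∣n =
    subst (_∣ ∣ c n ∣) (trans (gcd[∣c∣]≡∣c[gcd]∣ m>0 n>0) (cong (∣_∣ ∘ c) gcd[m,n]≡m)) (gcd[m,n]∣n ∣ c m ∣ ∣ c n ∣)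
    where
    gcd[m,n]≡m : gcd m n ≡ m
    gcd[m,n]≡m = ∣-antisym (gcd[m,n]∣m m n) (gcd-greatest ∣-refl m∣n)

  rank∣ : ∀ {d j k} → IsRank c d j → 0 < k → d ∣ ∣ c k ∣ → j ∣ k
  rank∣ {d} {j} {k} (j>0 , d∣c[j] , minimal) k>0 d∣c[k] = subst (_∣ k) g≡j (gcd[m,n]∣n j k)
    where
    g : ℕ
    g = gcd j k
    g>0 : 0 < g
    g>0 = n≢0⇒n>0 (gcd[m,n]≢0 j k (inj₂ (n>0⇒n≢0 k>0)))
    d∣c[g] : d ∣ ∣ c g ∣
    d∣c[g] = subst (d ∣_) (gcd[∣c∣]≡∣c[gcd]∣ j>0 k>0) (gcd-greatest d∣c[j] d∣c[k])
    g≡j : g ≡ j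
    g≡j = ≤-antisym (∣⇒≤ {{>-nonZero j>0}} (gcd[m,n]∣m j k)) (≮⇒≥ λ g<j → minimal g g>0 g<j d∣c[g])

module IdealPrime {c : ℕ → ℤ} (sds : StrongDivSeq c) {p : ℕ} (p-prime : Prime p)
                  {α : ℕ → ℕ} {s : ℕ} (ideal : Ideal c p α s) where

  open StrongDivSeqProperties sds
  open Valuation p p-prime
  open Ideal ideal

  α>0 : ∀ {j} → 0 < j → 0 < α j
  α>0 j>0 = proj₁ (rank _ j>0)

  instance
    α[1]≢0 : NonZero (α 1)
    α[1]≢0 = >-nonZero (α>0 z<s)

  α[j]∣k⇒p^j∣c[k] : ∀ {j k} → 0 < j → 0 < k → α j ∣ k → p ^ j ∣ ∣ c k ∣
  α[j]∣k⇒p^j∣c[k] j>0 k>0 α[j]∣k =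
    ∣-trans (proj₁ (proj₂ (rank _ j>0))) (m∣n⇒∣c[m]∣∣∣c[n]∣ (α>0 j>0) k>0 α[j]∣k)

  p^j∣c[k]⇒α[j]∣k : ∀ {j k} → 0 < j → 0 < k → p ^ j ∣ ∣ c k ∣ → α j ∣ k
  p^j∣c[k]⇒α[j]∣k j>0 = rank∣ (rank _ j>0)

  α[j]≡α[1] : ∀ {j} → 0 < j → j ≤ s → α j ≡ α 1
  α[j]≡α[1] {suc zero}    _ _     = refl
  α[j]≡α[1] {suc (suc j)} _ 2+j≤s = begin
    α (2 + j)      ≡⟨ a-one (2 + j) (s≤s (s≤s z≤n)) 2+j≤s ⟩
    1 * α (1 + j)  ≡⟨ *-identityˡ _ ⟩
    α (1 + j)      ≡⟨ α[j]≡α[1] {suc j} z<s (<⇒≤ 2+j≤s) ⟩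
    α 1            ∎

  α[s+t]≡p^t*α[1] : ∀ t → α (s + t) ≡ p ^ t * α 1
  α[s+t]≡p^t*α[1] zero    = trans (cong α (+-identityʳ s)) (trans (α[j]≡α[1] s≥1 ≤-refl) (sym (*-identityˡ _)))
  α[s+t]≡p^t*α[1] (suc t) = begin
    α (s + suc t)      ≡⟨ cong α (+-suc s t) ⟩
    α (suc (s + t))    ≡⟨ a-p (suc (s + t)) (s≤s (≤-trans s≥1 (m≤m+n s t))) (s≤s (m≤m+n s t)) ⟩
    p * α (s + t)      ≡⟨ cong (p *_) (α[s+t]≡p^t*α[1] t) ⟩
    p * (p ^ t * α 1)  ≡⟨ *-assoc p _ _ ⟨
    p ^ suc t * α 1    ∎

  α[1]∤k⇒ν[c[k]]≡0 : ∀ {k} → 0 < k → ¬ α 1 ∣ k → νℕ p ∣ c k ∣ ≡ 0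
  α[1]∤k⇒ν[c[k]]≡0 k>0 α[1]∤k = p^e∣n∧p^[1+e]∤n⇒ν≡e 0 (1∣ _) (α[1]∤k ∘ p^j∣c[k]⇒α[j]∣k z<s k>0)

  ν[c[α[1]*k]]≡s+ν[k] : ∀ {k} → 0 < k → νℕ p ∣ c (α 1 * k) ∣ ≡ s + νℕ p k
  ν[c[α[1]*k]]≡s+ν[k] {k} k>0 with ν-factor k>0
  ... | q , k≡p^v*q , p∤q = p^e∣n∧p^[1+e]∤n⇒ν≡e (s + v) p^[s+v]∣c[α[1]*k] p^[1+s+v]∤c[α[1]*k]
    where
    v x : ℕ
    v = νℕ p k
    x = p ^ v * α 1
    α[1]*k>0 : 0 < α 1 * k
    α[1]*k>0 = *-mono-≤ (α>0 z<s) k>0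
    α[1]*k≡x*q : α 1 * k ≡ x * q
    α[1]*k≡x*q = trans (cong (α 1 *_) k≡p^v*q) (a*[y*q]≡y*a*q (α 1) (p ^ v) q)
      where
      a*[y*q]≡y*a*q : ∀ a y q → a * (y * q) ≡ y * a * q
      a*[y*q]≡y*a*q = solve-∀
    p^[s+v]∣c[α[1]*k] : p ^ (s + v) ∣ ∣ c (α 1 * k) ∣
    p^[s+v]∣c[α[1]*k] = α[j]∣k⇒p^j∣c[k] (≤-trans s≥1 (m≤m+n s v)) α[1]*k>0
      (subst (_∣ α 1 * k) (sym (α[s+t]≡p^t*α[1] v)) (divides q (trans α[1]*k≡x*q (*-comm x q))))
    p^[1+s+v]∤c[α[1]*k] : ¬ p ^ suc (s + v) ∣ ∣ c (α 1 * k) ∣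
    p^[1+s+v]∤c[α[1]*k] p^[1+s+v]∣ = p∤q (*-cancelˡ-∣ x {{x≢0}} (subst₂ _∣_ α[s+1+v]≡x*p α[1]*k≡x*q α[s+1+v]∣α[1]*k))
      where
      x≢0 : NonZero x
      x≢0 = m*n≢0 (p ^ v) (α 1) {{m^n≢0 p v}}
      α[s+1+v]∣α[1]*k : α (s + suc v) ∣ α 1 * k
      α[s+1+v]∣α[1]*k = p^j∣c[k]⇒α[j]∣k (≤-trans s≥1 (m≤m+n s (suc v))) α[1]*k>0
        (subst (λ e → p ^ e ∣ ∣ c (α 1 * k) ∣) (sym (+-suc s v)) p^[1+s+v]∣)
      α[s+1+v]≡x*p : α (s + suc v) ≡ x * p
      α[s+1+v]≡x*p = trans (α[s+t]≡p^t*α[1] (suc v)) (trans (*-assoc p (p ^ v) (α 1)) (*-comm p x))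

  νorial : ℕ → ℕ
  νorial n = νℤ p (orial c n)

  orial>0 : ∀ n → 0 < ∣ orial c n ∣
  orial>0 zero    = z<s
  orial>0 (suc n) = subst (0 <_) (sym (abs-* (c (suc n)) (orial c n))) (*-mono-≤ (∣c∣>0 z<s) (orial>0 n))

  νorial-suc : ∀ n → νorial (suc n) ≡ νℕ p ∣ c (suc n) ∣ + νorial n
  νorial-suc n = trans (cong (νℕ p) (abs-* (c (suc n)) (orial c n))) (ν[m*n]≡ν[m]+ν[n] (∣c∣>0 z<s) (orial>0 n))

  νorial[α*q+r]≡νorial[α*q] : ∀ q {r} → r < α 1 → νorial (α 1 * q + r) ≡ νorial (α 1 * q)
  νorial[α*q+r]≡νorial[α*q] q {zero}  _     = cong νorial (+-identityʳ (α 1 * q))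
  νorial[α*q+r]≡νorial[α*q] q {suc r} 1+r<α = begin
    νorial (α 1 * q + suc r)                                ≡⟨ cong νorial (+-suc (α 1 * q) r) ⟩
    νorial (suc (α 1 * q + r))                              ≡⟨ νorial-suc (α 1 * q + r) ⟩
    νℕ p ∣ c (suc (α 1 * q + r)) ∣ + νorial (α 1 * q + r)   ≡⟨ cong₂ _+_ ν[c]≡0 (νorial[α*q+r]≡νorial[α*q] q (<⇒≤ 1+r<α)) ⟩
    νorial (α 1 * q)                                        ∎
    where
    ν[c]≡0 : νℕ p ∣ c (suc (α 1 * q + r)) ∣ ≡ 0
    ν[c]≡0 = α[1]∤k⇒ν[c[k]]≡0 z<s (subst (¬_ ∘ (α 1 ∣_)) (+-suc (α 1 * q) r) (m∤m*q+r q z<s 1+r<α))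

  νorial[α*q]≡s*q+ν[q!] : ∀ q → νorial (α 1 * q) ≡ s * q + νℕ p (q !)
  νorial[α*q]≡s*q+ν[q!] zero = begin
    νorial (α 1 * 0)   ≡⟨ cong νorial (*-zeroʳ (α 1)) ⟩
    νℕ p 1             ≡⟨ ν[1]≡0 ⟩
    0                  ≡⟨ cong₂ _+_ (*-zeroʳ s) ν[1]≡0 ⟨
    s * 0 + νℕ p 1     ∎
  νorial[α*q]≡s*q+ν[q!] (suc q) = begin
    νorial (α 1 * suc q)                                       ≡⟨ cong νorial α*[1+q]≡1+[α*q+r] ⟩
    νorial (suc (α 1 * q + r))                                 ≡⟨ νorial-suc (α 1 * q + r) ⟩
    νℕ p ∣ c (suc (α 1 * q + r)) ∣ + νorial (α 1 * q + r)      ≡⟨ cong₂ _+_ ν[c[α*[1+q]]] νorial[α*q+r] ⟩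
    (s + νℕ p (suc q)) + (s * q + νℕ p (q !))                  ≡⟨ regroup s (νℕ p (suc q)) q (νℕ p (q !)) ⟩
    s * suc q + (νℕ p (suc q) + νℕ p (q !))                    ≡⟨ cong (s * suc q +_) (ν[m*n]≡ν[m]+ν[n] z<s (1≤n! q)) ⟨
    s * suc q + νℕ p (suc q !)                                 ∎
    where
    r : ℕ
    r = pred (α 1)
    α*[1+q]≡1+[α*q+r] : α 1 * suc q ≡ suc (α 1 * q + r)
    α*[1+q]≡1+[α*q+r] = begin
      α 1 * suc q          ≡⟨ *-suc (α 1) q ⟩
      α 1 + α 1 * q        ≡⟨ +-comm (α 1) (α 1 * q) ⟩
      α 1 * q + α 1        ≡⟨ cong (α 1 * q +_) (suc-pred (α 1)) ⟨
      α 1 * q + suc r      ≡⟨ +-suc (α 1 * q) r ⟩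
      suc (α 1 * q + r)    ∎
    ν[c[α*[1+q]]] : νℕ p ∣ c (suc (α 1 * q + r)) ∣ ≡ s + νℕ p (suc q)
    ν[c[α*[1+q]]] = trans (cong (νℕ p ∘ ∣_∣ ∘ c) (sym α*[1+q]≡1+[α*q+r])) (ν[c[α[1]*k]]≡s+ν[k] z<s)
    νorial[α*q+r] : νorial (α 1 * q + r) ≡ s * q + νℕ p (q !)
    νorial[α*q+r] = trans (νorial[α*q+r]≡νorial[α*q] q (subst (r <_) (suc-pred (α 1)) (n<1+n r))) (νorial[α*q]≡s*q+ν[q!] q)
    regroup : ∀ s x q y → (s + x) + (s * q + y) ≡ s * (1 + q) + (x + y)
    regroup = solve-∀

  νorial[α*q+r]≡s*q+ν[q!] : ∀ q {r} → r < α 1 → νorial (α 1 * q + r) ≡ s * q + νℕ p (q !)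
  νorial[α*q+r]≡s*q+ν[q!] q r<α = trans (νorial[α*q+r]≡νorial[α*q] q r<α) (νorial[α*q]≡s*q+ν[q!] q)

  νorial-split⇒νCbinom≡ : ∀ m d {X} → νorial (m + d) ≡ X + (νorial m + νorial d) → νCbinom c p (m + d) m ≡ X
  νorial-split⇒νCbinom≡ m d {X} νorial-split = begin
    νorial (m + d) ∸ (νorial m + νorial (m + d ∸ m))  ≡⟨ cong (λ t → νorial (m + d) ∸ (νorial m + νorial t)) (m+n∸m≡n m d) ⟩
    νorial (m + d) ∸ (νorial m + νorial d)            ≡⟨ cong (_∸ (νorial m + νorial d)) νorial-split ⟩
    X + (νorial m + νorial d) ∸ (νorial m + νorial d) ≡⟨ m+n∸n≡m X (νorial m + νorial d) ⟩
    X                                                 ∎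

  νCbinom-no-borrow : ∀ {n' r j i} → r < α 1 → j ≤ n' → i ≤ r →
    νCbinom c p (α 1 * n' + r) (α 1 * j + i) ≡ νℕ p (n' C j)
  νCbinom-no-borrow {j = j} {i} r<α j≤n' i≤r with m≤n⇒∃[o]m+o≡n j≤n' | m≤n⇒∃[o]m+o≡n i≤r
  ... | d , refl | e , refl = subst (λ n → νCbinom c p n (α 1 * j + i) ≡ X) (sym n≡m+[n∸m]) (νorial-split⇒νCbinom≡ (α 1 * j + i) (α 1 * d + e) νorial-split)
    where
    n≡m+[n∸m] : α 1 * (j + d) + (i + e) ≡ (α 1 * j + i) + (α 1 * d + e)
    n≡m+[n∸m] = regroup (α 1) j d i e
      where
      regroup : ∀ a j d i e → a * (j + d) + (i + e) ≡ (a * j + i) + (a * d + e)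
      regroup = solve-∀
    X : ℕ
    X = νℕ p ((j + d) C j)
    νorial-split : νorial ((α 1 * j + i) + (α 1 * d + e)) ≡ X + (νorial (α 1 * j + i) + νorial (α 1 * d + e))
    νorial-split = begin
      νorial ((α 1 * j + i) + (α 1 * d + e))                  ≡⟨ cong νorial n≡m+[n∸m] ⟨
      νorial (α 1 * (j + d) + (i + e))                        ≡⟨ νorial[α*q+r]≡s*q+ν[q!] (j + d) r<α ⟩
      s * (j + d) + νℕ p ((j + d) !)                          ≡⟨ cong (s * (j + d) +_) (ν[[k+d]!]≡ν[[k+d]Ck]+ν[k!]+ν[d!] j d) ⟩
      s * (j + d) + (X + (νℕ p (j !) + νℕ p (d !)))           ≡⟨ regroup s j d X (νℕ p (j !)) (νℕ p (d !)) ⟩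
      X + ((s * j + νℕ p (j !)) + (s * d + νℕ p (d !)))       ≡⟨ cong (X +_) (cong₂ _+_
                                                                   (νorial[α*q+r]≡s*q+ν[q!] j (≤-<-trans (m≤m+n i e) r<α))
                                                                   (νorial[α*q+r]≡s*q+ν[q!] d (≤-<-trans (m≤n+m e i) r<α))) ⟨
      X + (νorial (α 1 * j + i) + νorial (α 1 * d + e))       ∎
      where
      regroup : ∀ s j d x y z → s * (j + d) + (x + (y + z)) ≡ x + ((s * j + y) + (s * d + z))
      regroup = solve-∀

  νCbinom-borrow : ∀ {n' r j i} → j < n' → r < i → i < α 1 →
    νCbinom c p (α 1 * n' + r) (α 1 * j + i) ≡ s + νℕ p (n' * ((n' ∸ 1) C j))
  νCbinom-borrow {r = r} {j} {i} j<n' r<i i<α with m≤n⇒∃[o]m+o≡n j<n' | m≤n⇒∃[o]m+o≡n i<α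
  ... | d , refl | f , 1+i+f≡α =
    subst (λ n → νCbinom c p n (α 1 * j + i) ≡ s + X) (sym n≡m+[n∸m]) (νorial-split⇒νCbinom≡ (α 1 * j + i) (α 1 * d + (suc f + r)) νorial-split)
    where
    n' : ℕ
    n' = suc (j + d)
    n≡m+[n∸m] : α 1 * n' + r ≡ (α 1 * j + i) + (α 1 * d + (suc f + r))
    n≡m+[n∸m] = split 1+i+f≡α
      where
      regroup : ∀ i f j d r → (1 + i + f) * (1 + (j + d)) + r ≡ ((1 + i + f) * j + i) + ((1 + i + f) * d + (1 + f + r))
      regroup = solve-∀
      -- α 1 is not a variable, so it is abstracted before being unfolded to suc i + f.
      split : ∀ {a} → suc i + f ≡ a → a * n' + r ≡ (a * j + i) + (a * d + (suc f + r))
      split refl = regroup i f j d r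
    1+f+r<α : suc f + r < α 1
    1+f+r<α = subst (suc f + r <_) (trans (cong suc (+-comm f i)) 1+i+f≡α) (+-monoʳ-< (suc f) r<i)
    X Y : ℕ
    X = νℕ p (n' * ((j + d) C j))
    Y = νℕ p ((j + d) C j)
    νorial-split : νorial ((α 1 * j + i) + (α 1 * d + (suc f + r)))
                 ≡ (s + X) + (νorial (α 1 * j + i) + νorial (α 1 * d + (suc f + r)))
    νorial-split = begin
      νorial ((α 1 * j + i) + (α 1 * d + (suc f + r)))                      ≡⟨ cong νorial n≡m+[n∸m] ⟨
      νorial (α 1 * n' + r)                                                 ≡⟨ νorial[α*q+r]≡s*q+ν[q!] n' (<-trans r<i i<α) ⟩
      s * n' + νℕ p (n' !)                                                  ≡⟨ cong (s * n' +_) ν[n'!] ⟩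
      s * n' + (νℕ p n' + (Y + (νℕ p (j !) + νℕ p (d !))))                  ≡⟨ regroup s j d (νℕ p n') Y (νℕ p (j !)) (νℕ p (d !)) ⟩
      (s + (νℕ p n' + Y)) + ((s * j + νℕ p (j !)) + (s * d + νℕ p (d !)))   ≡⟨ cong₂ _+_
                                                                                 (cong (s +_) (ν[m*n]≡ν[m]+ν[n] z<s (nCk>0 (m≤m+n j d))))
                                                                                 (cong₂ _+_ (νorial[α*q+r]≡s*q+ν[q!] j i<α)
                                                                                            (νorial[α*q+r]≡s*q+ν[q!] d 1+f+r<α)) ⟨
      (s + X) + (νorial (α 1 * j + i) + νorial (α 1 * d + (suc f + r)))     ∎
      where
      ν[n'!] : νℕ p (n' !) ≡ νℕ p n' + (Y + (νℕ p (j !) + νℕ p (d !)))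
      ν[n'!] = trans (ν[m*n]≡ν[m]+ν[n] z<s (1≤n! (j + d))) (cong (νℕ p n' +_) (ν[[k+d]!]≡ν[[k+d]Ck]+ν[k!]+ν[d!] j d))
      regroup : ∀ s j d n y a b → s * (1 + (j + d)) + (n + (y + (a + b))) ≡ (s + (n + y)) + ((s * j + a) + (s * d + b))
      regroup = solve-∀

lemma3p2 : (c : ℕ → ℤ) → StrongDivSeq c → (p : ℕ) → Prime p
    → (α : ℕ → ℕ) → (s : ℕ) → Ideal c p α s
    → (n n' r : ℕ) → r < α 1 → n ≡ α 1 * n' + r
    → (x : ℕ)
    → Σ< (suc n) (λ m → x ^ νCbinom c p n m)
      ≡ (r + 1) * Σ< (suc n') (λ m' → x ^ νℕ p (n' C m'))
        + (α 1 ∸ r ∸ 1) * x ^ (s ∸ 1)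
          * Σ< n' (λ m' → x ^ (1 + νℕ p (n' * ((n' ∸ 1) C m'))))
lemma3p2 c sds p p-prime α s ideal _ n' r r<α refl x = begin
  Σ< (suc (α 1 * n' + r)) (λ m → x ^ νCbinom c p (α 1 * n' + r) m)
    ≡⟨ Σ<-periodic (α 1) n' r r<α (λ j≤n' i≤r → cong (x ^_) (νCbinom-no-borrow r<α j≤n' i≤r)) x^νCbinom-borrow ⟩
  (r + 1) * Σ< (suc n') u + k * Σ< n' (λ j → x ^ (s ∸ 1) * w j)
    ≡⟨ cong (λ t → (r + 1) * Σ< (suc n') u + k * t) (Σ<-*ˡ n' (x ^ (s ∸ 1)) w) ⟩
  (r + 1) * Σ< (suc n') u + k * (x ^ (s ∸ 1) * Σ< n' w)
    ≡⟨ cong ((r + 1) * Σ< (suc n') u +_) (*-assoc k (x ^ (s ∸ 1)) (Σ< n' w)) ⟨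
  (r + 1) * Σ< (suc n') u + k * x ^ (s ∸ 1) * Σ< n' w ∎
  where
  open IdealPrime sds p-prime ideal
  k : ℕ
  k = α 1 ∸ r ∸ 1
  u w : ℕ → ℕ
  u j = x ^ νℕ p (n' C j)
  w j = x ^ (1 + νℕ p (n' * ((n' ∸ 1) C j)))
  x^νCbinom-borrow : ∀ {j i} → j < n' → r < i → i < α 1 → x ^ νCbinom c p (α 1 * n' + r) (α 1 * j + i) ≡ x ^ (s ∸ 1) * w j
  x^νCbinom-borrow j<n' r<i i<α =
    trans (cong (x ^_) (νCbinom-borrow j<n' r<i i<α)) (x^[s+y]≡x^[s∸1]*x^[1+y] x (Ideal.s≥1 ideal) _)
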